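{- Let $k \ge 3$, let $0 \le v < \lvert I_{k-2}\rvert$, and let $0 \le u \le 2^{k-1}-b_k$ be integers. Then $$\deg(B_{a_k+v})=\deg(B_{a_{k-2}+v})+1,$$ $$\deg(B_{b_k+u})=\deg(B_{a_{k-1}+u})+1,$$ $$\deg(B_{2^k-(b_k+u)})=\deg(B_{a_{k-1}+u})+1,$$ $$\deg(B_{c_k+v})=\deg(B_{2^{k-2}-(a_{k-2}+v)})+1.$$
   Context: The Stern polynomials $B_n(t)\in\mathbb{Z}[t]$ are defined by $B_0=0$, $B_1=1$, $B_{2n}=tB_n$, $B_{2n+1}=B_n+B_{n+1}$; $\deg$ denotes the degree in $t$. A BSD representation of an integer $n$ is a digit string $(b_{m-1}\cdots b_0)$ with $b_j\in\{1,0,-1\}$ and $n=\sum b_j2^j$. A non-adjacent form (NAF) is a BSD representation in which no two adjacent digits are both nonzero; it is reduced if its leading digit $b_{m-1}$ is nonzero. Every positive integer has exactly one reduced NAF; its length is the NAF-bitlength of $n$. $I_k$ denotes the set of positive integers of NAF-bitlength $k$; it is a set of consecutive integers (e.g. $I_1=\{1\}$, $I_2=\{2\}$, $I_3=\{3,4,5\}$, $I_4=\{6,\dots,10\}$), and for $k\ge 3$, $\lvert I_k\rvert=2\lvert I_{k-2}\rvert+\lvert I_{k-1}\rvert$. Write $a_k=\min I_k$ for $k\ge1$ and $a_0=0$ (equivalently $a_1=1,a_2=2$, $a_k=2^{k-2}+a_{k-2}$). For $k\ge 3$, $I_k$ is partitioned into consecutive subintervals $\mathcal{A}_k$ (the first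 $\lvert I_{k-2}\rvert$ elements), $\mathcal{B}_k$ (the next $\lvert I_{k-1}\rvert$ elements) and $\mathcal{C}_k$ (the last $\lvert I_{k-2}\rvert$ elements), with minima $a_k$, $b_k=a_k+\lvert I_{k-2}\rvert$ and $c_k=b_k+\lvert I_{k-1}\rvert=2^{k-1}+a_{k-2}$ respectively. -}

module Defs where

open import Data.Nat using (ℕ; zero; suc; _+_; _*_; _∸_; _^_; ⌊_/2⌋)
open import Data.Bool using (Bool; true; false)
open import Data.List using (List; []; _∷_)

-- Polynomials in ℤ[t] whose coefficients lie in ℕ (all Stern polynomials do),
-- as coefficient lists, lowest degree first (trailing zeros allowed).
Poly : Set
Poly = List ℕ

_⊕_ : Poly → Poly → Poly
[] ⊕ q = q
(x ∷ p) ⊕ [] = x ∷ p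
(x ∷ p) ⊕ (y ∷ q) = (x + y) ∷ (p ⊕ q)

mulT : Poly → Poly
mulT p = 0 ∷ p

isZero : Poly → Bool
isZero [] = true
isZero (zero ∷ p) = isZero p
isZero (suc _ ∷ p) = false

-- degree in t: index of highest nonzero coefficient
-- (convention deg 0 := 0; the zero polynomial never occurs in the theorem).
deg : Poly → ℕ
deg [] = 0
deg (x ∷ p) with isZero p
... | true = 0
... | false = suc (deg p)

-- Stern polynomials with fuel; sternF f n = B_n whenever f ≥ n.
-- B_0 = 0, B_1 = 1, B_{2m} = t B_m, B_{2m+1} = B_m + B_{m+1}.
sternF : ℕ → ℕ → Poly
sternF _ zero = []
sternF _ (suc zero) = 1 ∷ []
sternF zero (suc (suc n)) = []
sternF (suc f) (suc (suc n)) with n Data.Nat.% 2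
  where open import Data.Nat using (_%_)
... | zero = mulT (sternF f (suc ⌊ n /2⌋))                      -- n+2 = 2(m) with m = n/2+1
... | suc _ = sternF f (suc ⌊ n /2⌋) ⊕ sternF f (suc (suc ⌊ n /2⌋))  -- n+2 = 2m+1, m = n/2+1

B : ℕ → Poly
B n = sternF n n

-- a_0 = 0, a_1 = 1, a_2 = 2, a_k = 2^(k-2) + a_(k-2): minimum of I_k
a : ℕ → ℕ
a zero = 0
a (suc zero) = 1
a (suc (suc zero)) = 2
a (suc (suc (suc k))) = 2 ^ (suc k) + a (suc k)

-- |I_k| for k ≥ 1: |I_1| = |I_2| = 1, |I_k| = 2|I_(k-2)| + |I_(k-1)|  (|I_0| := 0 unused)
sizeI : ℕ → ℕ
sizeI zero = 0
sizeI (suc zero) = 1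
sizeI (suc (suc zero)) = 1
sizeI (suc (suc (suc k))) = 2 * sizeI (suc k) + sizeI (suc (suc k))

b : ℕ → ℕ
b k = a k + sizeI (k ∸ 2)

c : ℕ → ℕ
c k = b k + sizeI (k ∸ 1)

{-# OPTIONS --safe #-}

-- Let δ n = deg B_n.  As the coefficients of B_n are natural numbers, the
-- recursion gives δ (2n) = δ n + 1 for n ≥ 1 and δ (2n+1) = max (δ n) (δ (n+1)).
-- All four identities are instances of two statements about a level m:
--   shift:       δ (2^m + x) = δ x + 1        for m ≥ 1, a_m ≤ x + 1 and x ≤ 2^m,
--   reflection:  δ (3·2^m − y) = δ y + 1      for a_m ≤ y ≤ 2^m.
-- Both follow by induction on m: two even arguments halve to one pair of the level
-- below, two odd arguments to two neighbouring pairs, and the lower bound a_m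
-- survives halving because 2 a_m ≤ a_(m+1) + 1.  The only pair escaping the
-- induction is y = a_m odd in the reflection; then a_m = 2 a_(m-1) − 1 with
-- a_(m-1) even, and |δ (n+1) − δ n| ≤ 1 shows that the odd neighbours of an even
-- number never have larger degree, which settles it.
module Submission where

open import Defs
open import Data.Nat using (ℕ; suc; _+_; _∸_; _^_; _≤_; _<_)
open import Data.Product using (_×_)
open import Relation.Binary.PropositionalEquality using (_≡_)

open import Data.Nat using (zero; _*_; _%_; _⊔_; ⌊_/2⌋; s≤s; z≤n)
open import Data.Product using (Σ; _,_; proj₁; proj₂)
open import Data.Sum using (_⊎_; inj₁; inj₂)
open import Relation.Nullary using (contradiction; yes; no)
open import Data.Bool using (true; false; _∧_)
open import Data.List using ([]; _∷_)
open import Data.Nat.Properties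
open import Data.Nat.Induction using (<-rec)
open import Data.Nat.Solver using (module +-*-Solver)
open import Algebra.Properties.CommutativeSemigroup +-commutativeSemigroup using (interchange)
open import Relation.Binary.PropositionalEquality
  using (_≢_; refl; sym; trans; cong; cong₂; subst; subst₂; module ≡-Reasoning)
open +-*-Solver using (solve; _:+_; _:*_; _:=_; con)

-- Degrees of Stern polynomials

isZero-⊕ : ∀ p q → isZero (p ⊕ q) ≡ isZero p ∧ isZero q
isZero-⊕ [] q = refl
isZero-⊕ (x ∷ p) [] with isZero (x ∷ p)
... | true = refl
... | false = refl
isZero-⊕ (zero ∷ p) (zero ∷ q) = isZero-⊕ p q
isZero-⊕ (zero ∷ p) (suc y ∷ q) with isZero p
... | true = refl
... | false = refl
isZero-⊕ (suc x ∷ p) (y ∷ q) = refl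

isZero-⊕-nonzeroˡ : ∀ p {q} → isZero p ≡ false → isZero (p ⊕ q) ≡ false
isZero-⊕-nonzeroˡ p {q} p≢0 = trans (isZero-⊕ p q) (cong (_∧ isZero q) p≢0)

deg-∷-nonzero : ∀ x p → isZero p ≡ false → deg (x ∷ p) ≡ suc (deg p)
deg-∷-nonzero x p e rewrite e = refl

deg-zero : ∀ p → isZero p ≡ true → deg p ≡ 0
deg-zero [] _ = refl
deg-zero (zero ∷ p) e rewrite e = refl

deg-⊕ : ∀ p q → deg (p ⊕ q) ≡ deg p ⊔ deg q
deg-⊕ [] q = refl
deg-⊕ (x ∷ p) [] = sym (⊔-identityʳ (deg (x ∷ p)))
deg-⊕ (x ∷ p) (y ∷ q) rewrite isZero-⊕ p q with isZero p in ep | isZero q in eq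
... | true  | true  = refl
... | true  | false = cong suc (trans (deg-⊕ p q) (cong (_⊔ deg q) (deg-zero p ep)))
... | false | true  =
  cong suc (trans (deg-⊕ p q) (trans (cong (deg p ⊔_) (deg-zero q eq)) (⊔-identityʳ (deg p))))
... | false | false = cong suc (deg-⊕ p q)

half-fuel : ∀ {n f} → suc n ≤ f → suc ⌊ n /2⌋ ≤ f
half-fuel {n} = ≤-trans (s≤s (⌊n/2⌋≤n n))

half+1-fuel : ∀ {n f} → suc (suc n) ≤ f → suc (suc ⌊ suc n /2⌋) ≤ f
half+1-fuel {n} = ≤-trans (s≤s (⌊n/2⌋<n n))

sternF-fuel : ∀ {f g} n → n ≤ f → n ≤ g → sternF f n ≡ sternF g n
sternF-fuel zero _ _ = refl
sternF-fuel (suc zero) _ _ = refl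
sternF-fuel {suc f} {suc g} (suc (suc zero)) _ _ = refl
sternF-fuel {suc f} {suc g} (suc (suc (suc n))) (s≤s n<f) (s≤s n<g) with suc n % 2
... | zero  = cong mulT (sternF-fuel _ (half-fuel n<f) (half-fuel n<g))
... | suc _ = cong₂ _⊕_ (sternF-fuel _ (half-fuel n<f) (half-fuel n<g))
                        (sternF-fuel _ (half+1-fuel n<f) (half+1-fuel n<g))

sternF≡B : ∀ {f} n → n ≤ f → sternF f n ≡ B n
sternF≡B n n≤f = sternF-fuel n n≤f ≤-refl

sternF-nonzero : ∀ {f} n → suc n ≤ f → isZero (sternF f (suc n)) ≡ false
sternF-nonzero zero _ = refl
sternF-nonzero {suc f} (suc zero) _ = refl
sternF-nonzero {suc f} (suc (suc n)) (s≤s n<f) with suc n % 2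
... | zero  = sternF-nonzero _ (half-fuel n<f)
... | suc _ = isZero-⊕-nonzeroˡ (sternF f (suc ⌊ suc n /2⌋)) (sternF-nonzero _ (half-fuel n<f))

B-nonzero : ∀ n → isZero (B (suc n)) ≡ false
B-nonzero n = sternF-nonzero n ≤-refl

double%2 : ∀ n → (n + n) % 2 ≡ 0
double%2 zero = refl
double%2 (suc n) rewrite +-suc n n = double%2 n

double+1%2 : ∀ n → suc (n + n) % 2 ≡ 1
double+1%2 zero = refl
double+1%2 (suc n) rewrite +-suc n n = double+1%2 n

B-double : ∀ n → B (suc n + suc n) ≡ mulT (B (suc n))
B-double n rewrite +-suc n n | double%2 n | sym (n≡⌊n+n/2⌋ n) =
  cong mulT (sternF≡B (suc n) (s≤s (m≤m+n n n)))

B-double+1 : ∀ n → B (suc (n + n)) ≡ B n ⊕ B (suc n)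
B-double+1 zero = refl
B-double+1 (suc n) rewrite +-suc n n | double+1%2 n | sym (n≡⌈n+n/2⌉ n) =
  cong₂ _⊕_ (sternF≡B (suc n) (s≤s (m≤n⇒m≤1+n (m≤m+n n n))))
            (sternF≡B (suc (suc n)) (s≤s (s≤s (m≤m+n n n))))

degB : ℕ → ℕ
degB n = deg (B n)

degB-double : ∀ n → degB (suc n + suc n) ≡ suc (degB (suc n))
degB-double n = trans (cong deg (B-double n)) (deg-∷-nonzero 0 (B (suc n)) (B-nonzero n))

degB-suc-suc-double : ∀ n → degB (suc (suc (n + n))) ≡ suc (degB (suc n))
degB-suc-suc-double n = trans (cong degB (cong suc (sym (+-suc n n)))) (degB-double n)

degB-double+1 : ∀ n → degB (suc (n + n)) ≡ degB n ⊔ degB (suc n)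
degB-double+1 n = trans (cong deg (B-double+1 n)) (deg-⊕ (B n) (B (suc n)))

-- Neighbouring degrees

data Parity : ℕ → Set where
  even : ∀ h → Parity (h + h)
  odd  : ∀ h → Parity (suc (h + h))

parity : ∀ n → Parity n
parity zero = even zero
parity (suc n) with parity n
... | even h = odd h
... | odd h  = subst Parity (cong suc (+-suc h h)) (even (suc h))

degB[1+2n]≤degB[2+2n] : ∀ n → degB n ≤ suc (degB (suc n)) → degB (suc (n + n)) ≤ degB (suc (suc (n + n)))
degB[1+2n]≤degB[2+2n] n step = begin
  degB (suc (n + n))         ≡⟨ degB-double+1 n ⟩
  degB n ⊔ degB (suc n)      ≤⟨ ⊔-lub step (n≤1+n _) ⟩
  suc (degB (suc n))         ≡⟨ degB-suc-suc-double n ⟨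
  degB (suc (suc (n + n)))   ∎
  where open ≤-Reasoning

degB[3+2n]≤degB[2+2n] : ∀ n → degB (suc (suc n)) ≤ suc (degB (suc n)) →
                        degB (suc (suc n + suc n)) ≤ degB (suc n + suc n)
degB[3+2n]≤degB[2+2n] n step = begin
  degB (suc (suc n + suc n))         ≡⟨ degB-double+1 (suc n) ⟩
  degB (suc n) ⊔ degB (suc (suc n))  ≤⟨ ⊔-lub (n≤1+n _) step ⟩
  suc (degB (suc n))                 ≡⟨ degB-double n ⟨
  degB (suc n + suc n)               ∎
  where open ≤-Reasoning

degB[2+2n]≤1+degB[1+2n] : ∀ n → degB (suc (suc (n + n))) ≤ suc (degB (suc (n + n)))
degB[2+2n]≤1+degB[1+2n] n = begin
  degB (suc (suc (n + n)))       ≡⟨ degB-suc-suc-double n ⟩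
  suc (degB (suc n))             ≤⟨ s≤s (m≤n⊔m _ _) ⟩
  suc (degB n ⊔ degB (suc n))    ≡⟨ cong suc (degB-double+1 n) ⟨
  suc (degB (suc (n + n)))       ∎
  where open ≤-Reasoning

degB[2+2n]≤1+degB[3+2n] : ∀ n → degB (suc n + suc n) ≤ suc (degB (suc (suc n + suc n)))
degB[2+2n]≤1+degB[3+2n] n = begin
  degB (suc n + suc n)                     ≡⟨ degB-double n ⟩
  suc (degB (suc n))                       ≤⟨ s≤s (m≤m⊔n _ _) ⟩
  suc (degB (suc n) ⊔ degB (suc (suc n)))  ≡⟨ cong suc (degB-double+1 (suc n)) ⟨
  suc (degB (suc (suc n + suc n)))         ∎
  where open ≤-Reasoning

StepBounded : ℕ → Set
StepBounded n = degB (suc n) ≤ suc (degB n) × degB n ≤ suc (degB (suc n))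

degB-stepBounded : ∀ n → StepBounded n
degB-stepBounded = <-rec StepBounded bound
  where
  bound : ∀ n → (∀ {m} → m < n → StepBounded m) → StepBounded n
  bound n ih with parity n
  ... | even zero    = z≤n , z≤n
  ... | even (suc h) =
    ≤-trans (degB[3+2n]≤degB[2+2n] h (proj₁ (ih (s≤s (m≤n+m (suc h) h))))) (n≤1+n _) ,
    degB[2+2n]≤1+degB[3+2n] h
  ... | odd h =
    degB[2+2n]≤1+degB[1+2n] h ,
    ≤-trans (degB[1+2n]≤degB[2+2n] h (proj₂ (ih (s≤s (m≤m+n h h))))) (n≤1+n _)

-- A record rather than a synonym, so that z and x are inferable from its type.
record OneAbove (z x : ℕ) : Set where
  constructor oneAbove
  field degB≡suc : degB z ≡ suc (degB x)

oneAbove-double : ∀ {g h} → 0 < g → 0 < h → OneAbove g h → OneAbove (g + g) (h + h)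
oneAbove-double {suc g} {suc h} _ _ (oneAbove g↑h) = oneAbove (begin
  degB (suc g + suc g)        ≡⟨ degB-double g ⟩
  suc (degB (suc g))          ≡⟨ cong suc g↑h ⟩
  suc (suc (degB (suc h)))    ≡⟨ cong suc (degB-double h) ⟨
  suc (degB (suc h + suc h))  ∎)
  where open ≡-Reasoning

oneAbove-double+1 : ∀ {g h} → OneAbove g h → OneAbove (suc g) (suc h) →
                    OneAbove (suc (g + g)) (suc (h + h))
oneAbove-double+1 {g} {h} (oneAbove g↑h) (oneAbove g+1↑h+1) = oneAbove (begin
  degB (suc (g + g))              ≡⟨ degB-double+1 g ⟩
  degB g ⊔ degB (suc g)           ≡⟨ cong₂ _⊔_ g↑h g+1↑h+1 ⟩
  suc (degB h ⊔ degB (suc h))     ≡⟨ cong suc (degB-double+1 h) ⟨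
  suc (degB (suc (h + h)))        ∎)
  where open ≡-Reasoning

oneAbove-double+1-crossed : ∀ {g h} → OneAbove g (suc h) → OneAbove (suc g) h →
                            OneAbove (suc (g + g)) (suc (h + h))
oneAbove-double+1-crossed {g} {h} (oneAbove g↑h+1) (oneAbove g+1↑h) = oneAbove (begin
  degB (suc (g + g))              ≡⟨ degB-double+1 g ⟩
  degB g ⊔ degB (suc g)           ≡⟨ cong₂ _⊔_ g↑h+1 g+1↑h ⟩
  suc (degB (suc h) ⊔ degB h)     ≡⟨ cong suc (⊔-comm (degB (suc h)) (degB h)) ⟩
  suc (degB h ⊔ degB (suc h))     ≡⟨ cong suc (degB-double+1 h) ⟨
  suc (degB (suc (h + h)))        ∎)
  where open ≡-Reasoning

oneAbove-double+1-dominated : ∀ {g h} → degB (suc g) ≤ degB g → degB h ≤ degB (suc h) →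
                              OneAbove g (suc h) → OneAbove (suc (g + g)) (suc (h + h))
oneAbove-double+1-dominated {g} {h} g+1≤g h≤h+1 (oneAbove g↑h+1) = oneAbove (begin
  degB (suc (g + g))              ≡⟨ degB-double+1 g ⟩
  degB g ⊔ degB (suc g)           ≡⟨ m≥n⇒m⊔n≡m g+1≤g ⟩
  degB g                          ≡⟨ g↑h+1 ⟩
  suc (degB (suc h))              ≡⟨ cong suc (m≤n⇒m⊔n≡n h≤h+1) ⟨
  suc (degB h ⊔ degB (suc h))     ≡⟨ cong suc (degB-double+1 h) ⟨
  suc (degB (suc (h + h)))        ∎)
  where open ≡-Reasoning

-- Doubling and the sequence a

double≢double+1 : ∀ m n → m + m ≢ suc (n + n)
double≢double+1 m n eq = 0≢1+n (trans (sym (double%2 m)) (trans (cong (_% 2) eq) (double+1%2 n)))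

double-injective : ∀ {m n} → m + m ≡ n + n → m ≡ n
double-injective {m} {n} eq = trans (n≡⌊n+n/2⌋ m) (trans (cong ⌊_/2⌋ eq) (sym (n≡⌊n+n/2⌋ n)))

double-≤-cancel : ∀ {m n} → m + m ≤ suc (n + n) → m ≤ n
double-≤-cancel {m} {n} le = subst₂ _≤_ (sym (n≡⌊n+n/2⌋ m)) (sym (n≡⌈n+n/2⌉ n)) (⌊n/2⌋-mono le)

2^-double : ∀ m → 2 ^ suc m ≡ 2 ^ m + 2 ^ m
2^-double m = cong (2 ^ m +_) (+-identityʳ (2 ^ m))

3*2^-double : ∀ m → 3 * 2 ^ suc m ≡ 3 * 2 ^ m + 3 * 2 ^ m
3*2^-double m = solve 1 (λ p → con 3 :* (con 2 :* p) := con 3 :* p :+ con 3 :* p) refl (2 ^ m)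

sizeI-sum : ∀ m → sizeI (suc m) + sizeI (suc (suc m)) ≡ 2 ^ suc m
sizeI-sum zero = refl
sizeI-sum (suc m) = begin
  s₂ + (2 * s₁ + s₂)
    ≡⟨ solve 2 (λ s₁ s₂ → s₂ :+ (con 2 :* s₁ :+ s₂) := (s₁ :+ s₂) :+ (s₁ :+ s₂)) refl s₁ s₂ ⟩
  (s₁ + s₂) + (s₁ + s₂)   ≡⟨ cong (λ s → s + s) (sizeI-sum m) ⟩
  2 ^ suc m + 2 ^ suc m   ≡⟨ 2^-double (suc m) ⟨
  2 ^ suc (suc m)         ∎
  where
  open ≡-Reasoning
  s₁ = sizeI (suc m)
  s₂ = sizeI (suc (suc m))

a+sizeI : ∀ m → a (suc m) + sizeI (suc m) ≡ a (suc (suc m))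
a+sizeI zero = refl
a+sizeI (suc zero) = refl
a+sizeI (suc (suc m)) = begin
  (p + a₁) + (2 * s₁ + s₂)
    ≡⟨ solve 4 (λ p a₁ s₁ s₂ → (p :+ a₁) :+ (con 2 :* s₁ :+ s₂) := p :+ (a₁ :+ s₁) :+ (s₁ :+ s₂)) refl p a₁ s₁ s₂ ⟩
  p + (a₁ + s₁) + (s₁ + s₂)        ≡⟨ cong₂ (λ x y → p + x + y) (a+sizeI m) (sizeI-sum m) ⟩
  p + a (suc (suc m)) + p
    ≡⟨ solve 2 (λ p a₂ → p :+ a₂ :+ p := (p :+ p) :+ a₂) refl p (a (suc (suc m))) ⟩
  (p + p) + a (suc (suc m))        ≡⟨ cong (_+ a (suc (suc m))) (2^-double (suc m)) ⟨
  2 ^ suc (suc m) + a (suc (suc m)) ∎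
  where
  open ≡-Reasoning
  p = 2 ^ suc m
  a₁ = a (suc m)
  s₁ = sizeI (suc m)
  s₂ = sizeI (suc (suc m))

a-sum : ∀ m → a (suc (suc m)) + a (suc m) ≡ suc (2 ^ suc m)
a-sum zero = refl
a-sum (suc m) = begin
  (p + a (suc m)) + a (suc (suc m))   ≡⟨ +-assoc p _ _ ⟩
  p + (a (suc m) + a (suc (suc m)))   ≡⟨ cong (p +_) (trans (+-comm (a (suc m)) _) (a-sum m)) ⟩
  p + suc p                           ≡⟨ +-suc p p ⟩
  suc (p + p)                         ≡⟨ cong suc (2^-double (suc m)) ⟨
  suc (2 ^ suc (suc m))               ∎
  where
  open ≡-Reasoning
  p = 2 ^ suc m

a-mono : ∀ m → a m ≤ a (suc m)
a-mono zero = z≤n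
a-mono (suc m) = ≤-trans (m≤m+n _ _) (≤-reflexive (a+sizeI m))

a≥2 : ∀ m → 2 ≤ a (suc (suc m))
a≥2 zero = ≤-refl
a≥2 (suc m) = ≤-trans (a≥2 m) (a-mono (suc (suc m)))

a-positive : ∀ m → 1 ≤ a (suc m)
a-positive zero = ≤-refl
a-positive (suc m) = ≤-trans (s≤s z≤n) (a≥2 m)

a-double-step : ∀ m → a (3 + m) + a (3 + m) ≡ 2 ^ (2 + m) + (a (suc m) + a (suc m))
a-double-step m = begin
  (p + a (suc m)) + (p + a (suc m))   ≡⟨ interchange p (a (suc m)) p (a (suc m)) ⟩
  (p + p) + (a (suc m) + a (suc m))   ≡⟨ cong (_+ (a (suc m) + a (suc m))) (2^-double (suc m)) ⟨
  2 ^ (2 + m) + (a (suc m) + a (suc m)) ∎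
  where
  open ≡-Reasoning
  p = 2 ^ suc m

a-doubling-alternates : ∀ m →
    (a (suc m) + a (suc m) ≡ a (2 + m) × a (2 + m) + a (2 + m) ≡ suc (a (3 + m)))
  ⊎ (a (suc m) + a (suc m) ≡ suc (a (2 + m)) × a (2 + m) + a (2 + m) ≡ a (3 + m))
a-doubling-alternates zero = inj₁ (refl , refl)
a-doubling-alternates (suc m) with a-doubling-alternates m
... | inj₁ (exact , overshoot) =
  inj₂ (overshoot , trans (a-double-step m) (cong (2 ^ (2 + m) +_) exact))
... | inj₂ (overshoot , exact) =
  inj₁ (exact , trans (a-double-step m) (trans (cong (2 ^ (2 + m) +_) overshoot) (+-suc _ _)))

a-double≤ : ∀ m → a m + a m ≤ suc (a (suc m))
a-double≤ zero = z≤n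
a-double≤ (suc m) with a-doubling-alternates m
... | inj₁ (exact , _) = m≤n⇒m≤1+n (≤-reflexive exact)
... | inj₂ (overshoot , _) = ≤-reflexive overshoot

a-overshoot-even : ∀ m → a m + a m ≡ suc (a (suc m)) → Σ ℕ (λ A → a m ≡ A + A)
a-overshoot-even zero ()
a-overshoot-even (suc zero) ()
a-overshoot-even (suc (suc m)) overshoot with a-doubling-alternates m
... | inj₁ (exact , _) = a (suc m) , sym exact
... | inj₂ (_ , exact) = contradiction (trans (sym exact) overshoot) (<⇒≢ (n<1+n _))

a-overshoot : ∀ m h → a (suc m) ≤ suc (h + h) → a m ≡ suc h → a m + a m ≡ suc (a (suc m))
a-overshoot m h a≤y am≡h+1 = ≤-antisym (a-double≤ m) (begin
  suc (a (suc m))         ≤⟨ s≤s a≤y ⟩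
  suc (suc (h + h))       ≡⟨ cong suc (+-suc h h) ⟨
  suc h + suc h           ≡⟨ cong₂ _+_ am≡h+1 am≡h+1 ⟨
  a m + a m               ∎)
  where open ≤-Reasoning

a-edge-odd : ∀ m h → a (suc m) ≤ suc (h + h) → a m ≡ suc h → Σ ℕ (λ t → h ≡ suc (t + t))
a-edge-odd m h a≤y am≡h+1 with a-overshoot-even m (a-overshoot m h a≤y am≡h+1)
... | zero , am≡0 = contradiction (trans (sym am≡h+1) am≡0) λ ()
... | suc t , am≡2t+2 = t , suc-injective (trans (sym am≡h+1) (trans am≡2t+2 (cong suc (+-suc t t))))

-- Shift by 2^m and reflection about 3·2^m

2^-split : ∀ m x → 2 ^ suc m + (x + x) ≡ (2 ^ m + x) + (2 ^ m + x)
2^-split m x = trans (cong (_+ (x + x)) (2^-double m)) (interchange (2 ^ m) (2 ^ m) x x)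

double≤2^-cancel : ∀ m {k} → k + k ≤ 2 ^ suc m → k ≤ 2 ^ m
double≤2^-cancel m 2k≤2p = double-≤-cancel (m≤n⇒m≤1+n (≤-trans 2k≤2p (≤-reflexive (2^-double m))))

double+1≤2^-cancel : ∀ m {k} → suc (k + k) ≤ 2 ^ suc m → suc k ≤ 2 ^ m
double+1≤2^-cancel m {k} 2k+1≤2p =
  double-≤-cancel (≤-trans (≤-reflexive (cong suc (+-suc k k)))
                           (s≤s (≤-trans 2k+1≤2p (≤-reflexive (2^-double m)))))

a-halve-even : ∀ m {k} → a (suc m) ≤ k + k → a m ≤ k
a-halve-even m a≤2k = double-≤-cancel (≤-trans (a-double≤ m) (s≤s a≤2k))

a-halve-odd : ∀ m {k} → a (suc m) ≤ suc (k + k) → a m ≤ suc k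
a-halve-odd m {k} a≤2k+1 = a-halve-even m (≤-trans a≤2k+1 (s≤s (+-monoʳ-≤ k (n≤1+n k))))

oneAbove-2^+ : ∀ m x → a (suc m) ≤ suc x → x ≤ 2 ^ suc m → OneAbove (2 ^ suc m + x) x
oneAbove-2^+ zero zero _ _ = oneAbove refl
oneAbove-2^+ zero (suc zero) _ _ = oneAbove refl
oneAbove-2^+ zero (suc (suc zero)) _ _ = oneAbove refl
oneAbove-2^+ zero (suc (suc (suc x))) _ (s≤s (s≤s ()))
oneAbove-2^+ (suc m) x a≤x+1 x≤2p with parity x
... | even zero = contradiction a≤x+1 (<⇒≱ (a≥2 m))
... | even (suc h) =
  subst (λ z → OneAbove z (suc h + suc h)) (sym (2^-split (suc m) (suc h)))
    (oneAbove-double (≤-trans (s≤s z≤n) (m≤n+m (suc h) (2 ^ suc m))) (s≤s z≤n)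
      (oneAbove-2^+ m (suc h) (a-halve-odd (suc m) a≤x+1) (double≤2^-cancel (suc m) x≤2p)))
... | odd h =
  subst (λ z → OneAbove z (suc (h + h)))
    (sym (trans (+-suc (2 ^ suc (suc m)) (h + h)) (cong suc (2^-split (suc m) h))))
    (oneAbove-double+1
      (oneAbove-2^+ m h a≤h+1 (double≤2^-cancel (suc m) (<⇒≤ x≤2p)))
      (subst (λ z → OneAbove z (suc h)) (+-suc (2 ^ suc m) h)
        (oneAbove-2^+ m (suc h) (m≤n⇒m≤1+n a≤h+1) (double+1≤2^-cancel (suc m) x≤2p))))
  where
  a≤h+1 : a (suc m) ≤ suc h
  a≤h+1 = a-halve-even (suc m) (≤-trans a≤x+1 (≤-reflexive (cong suc (sym (+-suc h h)))))

2^<3*2^ : ∀ m → 2 ^ m < 3 * 2 ^ m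
2^<3*2^ m = m<m+n (2 ^ m) (≤-trans (m^n>0 2 m) (m≤m+n _ _))

reflect-positive : ∀ m {g h} → g + h ≡ 3 * 2 ^ m → h ≤ 2 ^ m → 0 < g
reflect-positive m {zero} h≡3p h≤p =
  contradiction (≤-trans (≤-reflexive (sym h≡3p)) h≤p) (<⇒≱ (2^<3*2^ m))
reflect-positive m {suc g} _ _ = s≤s z≤n

double-positive : ∀ {h} → 0 < h + h → 0 < h
double-positive {suc h} _ = s≤s z≤n

odd≢double : ∀ g h q → suc ((g + g) + (h + h)) ≢ q + q
odd≢double g h q eq = double≢double+1 q (g + h) (sym (trans (cong suc (sym (interchange g g h h))) eq))

odd+odd : ∀ g h → suc (g + g) + suc (h + h) ≡ suc (g + h) + suc (g + h)
odd+odd = solve 2 (λ g h → (con 1 :+ (g :+ g)) :+ (con 1 :+ (h :+ h))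
                       := (con 1 :+ (g :+ h)) :+ (con 1 :+ (g :+ h))) refl

positive-even : ∀ {g A q} → 0 < g → g + (A + A) ≡ q + q → Σ ℕ (λ g′ → g ≡ suc g′ + suc g′)
positive-even {g} {A} {q} 0<g eq with parity g
... | even (suc g′) = g′ , refl
... | odd g′ = contradiction eq (odd≢double g′ A q)

oneAbove-double+1-atEdge : ∀ {g h} → Σ ℕ (λ g′ → g ≡ suc g′ + suc g′) →
                           Σ ℕ (λ t → h ≡ suc (t + t)) →
                           OneAbove g (suc h) → OneAbove (suc (g + g)) (suc (h + h))
oneAbove-double+1-atEdge (g′ , refl) (t , refl) =
  oneAbove-double+1-dominated
    (degB[3+2n]≤degB[2+2n] g′ (proj₁ (degB-stepBounded (suc g′))))
    (degB[1+2n]≤degB[2+2n] t (proj₂ (degB-stepBounded t)))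

Reflects : ℕ → Set
Reflects m = ∀ y w → a m ≤ y → y ≤ 2 ^ m → w + y ≡ 3 * 2 ^ m → OneAbove w y

reflects-even-step : ∀ m g h → Reflects m → a (suc m) ≤ h + h → h + h ≤ 2 ^ suc m →
                     g + h ≡ 3 * 2 ^ m → OneAbove (g + g) (h + h)
reflects-even-step m g h ih a≤y y≤2p g+h≡3p =
  oneAbove-double (reflect-positive m g+h≡3p h≤p) (double-positive (≤-trans (a-positive m) a≤y))
    (ih h g (a-halve-even m a≤y) h≤p g+h≡3p)
  where
  h≤p : h ≤ 2 ^ m
  h≤p = double≤2^-cancel m y≤2p

reflects-odd-step : ∀ m g h → Reflects m → a (suc m) ≤ suc (h + h) → suc (h + h) ≤ 2 ^ suc m →
                    suc (g + h) ≡ 3 * 2 ^ m → OneAbove (suc (g + g)) (suc (h + h))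
reflects-odd-step m g h ih a≤y y≤2p g+h+1≡3p with a m ≤? h
... | yes a≤h =
  oneAbove-double+1-crossed
    (ih (suc h) g (m≤n⇒m≤1+n a≤h) h+1≤p (trans (+-suc g h) g+h+1≡3p))
    (ih h (suc g) a≤h (<⇒≤ h+1≤p) g+h+1≡3p)
  where
  h+1≤p : suc h ≤ 2 ^ m
  h+1≤p = double+1≤2^-cancel m y≤2p
reflects-odd-step zero _ _ _ _ _ _ | no a≰h = contradiction z≤n a≰h
reflects-odd-step (suc m) g h ih a≤y y≤2p g+h+1≡3p | no a≰h =
  oneAbove-double+1-atEdge g-even h-odd (ih (suc h) g a≤h+1 h+1≤p g+[h+1]≡3p)
  where
  a≤h+1 : a (suc m) ≤ suc h
  a≤h+1 = a-halve-odd (suc m) a≤y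
  h+1≤p : suc h ≤ 2 ^ suc m
  h+1≤p = double+1≤2^-cancel (suc m) y≤2p
  g+[h+1]≡3p : g + suc h ≡ 3 * 2 ^ suc m
  g+[h+1]≡3p = trans (+-suc g h) g+h+1≡3p
  h-odd : Σ ℕ (λ t → h ≡ suc (t + t))
  h-odd = a-edge-odd (suc m) h a≤y (≤-antisym a≤h+1 (≰⇒> a≰h))
  t = proj₁ h-odd
  g-even : Σ ℕ (λ g′ → g ≡ suc g′ + suc g′)
  g-even = positive-even {A = suc t} {q = 3 * 2 ^ m} (reflect-positive (suc m) g+[h+1]≡3p h+1≤p) (begin
    g + (suc t + suc t)      ≡⟨ cong (λ z → g + suc z) (trans (+-suc t t) (sym (proj₂ h-odd))) ⟩
    g + suc h                ≡⟨ g+[h+1]≡3p ⟩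
    3 * 2 ^ suc m            ≡⟨ 3*2^-double m ⟩
    3 * 2 ^ m + 3 * 2 ^ m    ∎)
    where open ≡-Reasoning

oneAbove-reflect : ∀ m → Reflects m
oneAbove-reflect zero zero w _ _ w+0≡3 with trans (sym (+-identityʳ w)) w+0≡3
... | refl = oneAbove refl
oneAbove-reflect zero (suc zero) w _ _ w+1≡3 with +-cancelʳ-≡ 1 w 2 w+1≡3
... | refl = oneAbove refl
oneAbove-reflect zero (suc (suc y)) w _ (s≤s ()) _
oneAbove-reflect (suc m) y w a≤y y≤2p w+y≡6p with parity y | parity w | trans w+y≡6p (3*2^-double m)
... | even h | even g | w+y≡2q =
  reflects-even-step m g h (oneAbove-reflect m) a≤y y≤2p
    (double-injective (trans (sym (interchange g g h h)) w+y≡2q))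
... | even h | odd g | w+y≡2q = contradiction w+y≡2q (odd≢double g h (3 * 2 ^ m))
... | odd h | even g | w+y≡2q =
  contradiction (trans (sym (+-suc (g + g) (h + h))) w+y≡2q) (odd≢double g h (3 * 2 ^ m))
... | odd h | odd g | w+y≡2q =
  reflects-odd-step m g h (oneAbove-reflect m) a≤y y≤2p
    (double-injective (trans (sym (odd+odd g h)) w+y≡2q))

oneAbove-3*2^∸ : ∀ m y → a m ≤ y → y ≤ 2 ^ m → OneAbove (3 * 2 ^ m ∸ y) y
oneAbove-3*2^∸ m y a≤y y≤p =
  oneAbove-reflect m y (3 * 2 ^ m ∸ y) a≤y y≤p (m∸n+n≡m (≤-trans y≤p (m≤m+n (2 ^ m) _)))

-- The blocks 𝒜_k, ℬ_k and 𝒞_k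

b≡2^+a : ∀ n → b (3 + n) ≡ 2 ^ suc n + a (2 + n)
b≡2^+a n = trans (+-assoc (2 ^ suc n) (a (suc n)) _) (cong (2 ^ suc n +_) (a+sizeI n))

c≡2^+2^+a : ∀ n → c (3 + n) ≡ (2 ^ suc n + 2 ^ suc n) + a (suc n)
c≡2^+2^+a n = begin
  b (3 + n) + sizeI (2 + n)           ≡⟨ cong (_+ sizeI (2 + n)) (b≡2^+a n) ⟩
  (p + a (2 + n)) + sizeI (2 + n)     ≡⟨ +-assoc p _ _ ⟩
  p + (a (2 + n) + sizeI (2 + n))     ≡⟨ cong (p +_) (a+sizeI (suc n)) ⟩
  p + (p + a (suc n))                 ≡⟨ +-assoc p p _ ⟨
  (p + p) + a (suc n)                 ∎
  where
  open ≡-Reasoning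
  p = 2 ^ suc n

2^[2+m]∸[2^m+y] : ∀ m y → 2 ^ (2 + m) ∸ (2 ^ m + y) ≡ 3 * 2 ^ m ∸ y
2^[2+m]∸[2^m+y] m y = begin
  2 ^ (2 + m) ∸ (2 ^ m + y)       ≡⟨ ∸-+-assoc (2 ^ (2 + m)) (2 ^ m) y ⟨
  2 ^ (2 + m) ∸ 2 ^ m ∸ y          ≡⟨ cong (λ z → z ∸ 2 ^ m ∸ y) 4p≡3p+p ⟩
  3 * 2 ^ m + 2 ^ m ∸ 2 ^ m ∸ y    ≡⟨ cong (_∸ y) (m+n∸n≡m (3 * 2 ^ m) (2 ^ m)) ⟩
  3 * 2 ^ m ∸ y                    ∎
  where
  open ≡-Reasoning
  4p≡3p+p : 2 ^ (2 + m) ≡ 3 * 2 ^ m + 2 ^ m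
  4p≡3p+p = solve 1 (λ p → con 2 :* (con 2 :* p) := con 3 :* p :+ p) refl (2 ^ m)

3*p∸[p∸x] : ∀ p x → x ≤ p → 3 * p ∸ (p ∸ x) ≡ (p + p) + x
3*p∸[p∸x] p x x≤p = begin
  3 * p ∸ (p ∸ x)             ≡⟨ cong (_∸ (p ∸ x)) 3p≡2p+p ⟩
  (p + p) + p ∸ (p ∸ x)       ≡⟨ +-∸-assoc (p + p) (m∸n≤m p x) ⟩
  (p + p) + (p ∸ (p ∸ x))     ≡⟨ cong ((p + p) +_) (m∸[m∸n]≡n x≤p) ⟩
  (p + p) + x                 ∎
  where
  open ≡-Reasoning
  3p≡2p+p : 3 * p ≡ (p + p) + p
  3p≡2p+p = solve 1 (λ p → con 3 :* p := (p :+ p) :+ p) refl p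

a+[a+v]≤2^ : ∀ n v → v < sizeI (suc n) → a (suc n) + (a (suc n) + v) ≤ 2 ^ suc n
a+[a+v]≤2^ n v v<s = ≤-pred (begin-strict
  a (suc n) + (a (suc n) + v)      <⟨ +-monoʳ-< (a (suc n)) (+-monoʳ-< (a (suc n)) v<s) ⟩
  a (suc n) + (a (suc n) + sizeI (suc n)) ≡⟨ cong (a (suc n) +_) (a+sizeI n) ⟩
  a (suc n) + a (2 + n)            ≡⟨ +-comm (a (suc n)) _ ⟩
  a (2 + n) + a (suc n)            ≡⟨ a-sum n ⟩
  suc (2 ^ suc n)                  ∎)
  where open ≤-Reasoning

a+u≤2^ : ∀ n u → b (3 + n) + u ≤ 2 ^ (2 + n) → a (2 + n) + u ≤ 2 ^ suc n
a+u≤2^ n u b+u≤4p = +-cancelˡ-≤ p _ p (begin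
  p + (a (2 + n) + u)      ≡⟨ +-assoc p _ u ⟨
  (p + a (2 + n)) + u      ≡⟨ cong (_+ u) (b≡2^+a n) ⟨
  b (3 + n) + u            ≤⟨ b+u≤4p ⟩
  2 ^ (2 + n)              ≡⟨ 2^-double (suc n) ⟩
  p + p                    ∎)
  where
  open ≤-Reasoning
  p = 2 ^ suc n

oneAbove-on-𝒜 : ∀ n v → v < sizeI (suc n) → OneAbove (a (3 + n) + v) (a (suc n) + v)
oneAbove-on-𝒜 n v v<s =
  subst (λ z → OneAbove z x) (sym (+-assoc (2 ^ suc n) (a (suc n)) v))
    (oneAbove-2^+ n x (m≤n⇒m≤1+n (m≤m+n (a (suc n)) v)) (m+n≤o⇒n≤o (a (suc n)) (a+[a+v]≤2^ n v v<s)))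
  where x = a (suc n) + v

oneAbove-on-ℬ : ∀ n u → b (3 + n) + u ≤ 2 ^ (2 + n) → OneAbove (b (3 + n) + u) (a (2 + n) + u)
oneAbove-on-ℬ n u b+u≤4p =
  subst (λ z → OneAbove z y) (trans (sym (+-assoc (2 ^ suc n) _ u)) (cong (_+ u) (sym (b≡2^+a n))))
    (oneAbove-2^+ n y (m≤n⇒m≤1+n (≤-trans (a-mono (suc n)) (m≤m+n (a (2 + n)) u))) (a+u≤2^ n u b+u≤4p))
  where y = a (2 + n) + u

oneAbove-on-ℬ-mirrored : ∀ n u → b (3 + n) + u ≤ 2 ^ (2 + n) →
                         OneAbove (2 ^ (3 + n) ∸ (b (3 + n) + u)) (a (2 + n) + u)
oneAbove-on-ℬ-mirrored n u b+u≤4p =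
  subst (λ z → OneAbove z y) (trans (sym (2^[2+m]∸[2^m+y] (suc n) y)) (cong (2 ^ (3 + n) ∸_) 2^+y≡b+u))
    (oneAbove-3*2^∸ (suc n) y (≤-trans (a-mono (suc n)) (m≤m+n (a (2 + n)) u)) (a+u≤2^ n u b+u≤4p))
  where
  y = a (2 + n) + u
  2^+y≡b+u : 2 ^ suc n + y ≡ b (3 + n) + u
  2^+y≡b+u = trans (sym (+-assoc (2 ^ suc n) _ u)) (cong (_+ u) (sym (b≡2^+a n)))

oneAbove-on-𝒞 : ∀ n v → v < sizeI (suc n) → OneAbove (c (3 + n) + v) (2 ^ suc n ∸ (a (suc n) + v))
oneAbove-on-𝒞 n v v<s =
  subst (λ z → OneAbove z (p ∸ x)) (trans (3*p∸[p∸x] p x (m+n≤o⇒n≤o (a (suc n)) a+x≤p)) 2p+x≡c+v)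
    (oneAbove-3*2^∸ (suc n) (p ∸ x) (m+n≤o⇒m≤o∸n (a (suc n)) a+x≤p) (m∸n≤m p x))
  where
  p = 2 ^ suc n
  x = a (suc n) + v
  a+x≤p : a (suc n) + x ≤ p
  a+x≤p = a+[a+v]≤2^ n v v<s
  2p+x≡c+v : (p + p) + x ≡ c (3 + n) + v
  2p+x≡c+v = trans (sym (+-assoc (p + p) (a (suc n)) v)) (cong (_+ v) (sym (c≡2^+2^+a n)))

oneAbove⇒+1 : ∀ {z x} → OneAbove z x → deg (B z) ≡ deg (B x) + 1
oneAbove⇒+1 {x = x} (oneAbove z↑x) = trans z↑x (+-comm 1 (degB x))

mainTheorem2 : (k v u : ℕ) → 3 ≤ k → v < sizeI (k ∸ 2) → b k + u ≤ 2 ^ (k ∸ 1) →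
    (deg (B (a k + v)) ≡ deg (B (a (k ∸ 2) + v)) + 1)
    × (deg (B (b k + u)) ≡ deg (B (a (k ∸ 1) + u)) + 1)
    × (deg (B (2 ^ k ∸ (b k + u))) ≡ deg (B (a (k ∸ 1) + u)) + 1)
    × (deg (B (c k + v)) ≡ deg (B (2 ^ (k ∸ 2) ∸ (a (k ∸ 2) + v))) + 1)
mainTheorem2 (suc (suc (suc n))) v u _ v<s b+u≤4p =
    oneAbove⇒+1 (oneAbove-on-𝒜 n v v<s)
  , oneAbove⇒+1 (oneAbove-on-ℬ n u b+u≤4p)
  , oneAbove⇒+1 (oneAbove-on-ℬ-mirrored n u b+u≤4p)
  , oneAbove⇒+1 (oneAbove-on-𝒞 n v v<s)
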